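{- Let $G=(V,E)$ be a simple graph and fix a directed edge $\vec e=(a,b)$ with $\{a,b\}\in E$. Let $\pi,\pi'\in\Pi$ with $\pi\neq\pi'$, let $\vec P$ be a $(v,\pi)$-query-path and $\vec P'$ a $(v',\pi')$-query-path, for some $v,v'\in V$, both with last directed edge $\vec e$, and suppose $\phi(\pi,\vec P)=\phi(\pi',\vec P')$. Then $|\vec P|\neq|\vec P'|$.
   Context: $\Pi$ denotes the set of all bijections $\pi:E\to\{1,\dots,|E|\}$ (ranks). Vertex oracle $\mathrm{VO}(v,\pi)$: let $e_1=(v,u_1),\dots,e_k=(v,u_k)$ be the edges incident to $v$ with $\pi(e_1)<\dots<\pi(e_k)$; for $i=1,\dots,k$, if $\mathrm{EO}(e_i,u_i,\pi)$ returns true then return true; after the loop return false. Edge oracle $\mathrm{EO}(e,u,\pi)$, $u$ an endpoint of $e$: if $\mathrm{EO}(e,u,\pi)$ has already been computed during the current execution of the top-level vertex oracle call, return the stored answer (making no further calls). Otherwise let $e_1=(u,w_1),\dots,e_k=(u,w_k)$ be the edges incident to $u$ with $\pi(e_i)<\pi(e)$ and $\pi(e_1)<\dots<\pi(e_k)$; for $i=1,\dots,k$, if $\mathrm{EO}(e_i,w_i,\pi)$ returns true then return false; after the loop return true. Query paths: during the execution of $\mathrm{VO}(v,\pi)$ maintain a stack, pushing an edge when the edge oracle is called on it and popping it when that call returns. At any moment the edges in the stack, $(e_1,\dots,e_k)$ in push order, form a path in $G$ with $v\in e_1$; orienting it as a directed path $\vec P=(\vec e_1,\dots,\vec e_k)$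 starting at $v$ gives a $(v,\pi)$-query-path; its length $|\vec P|$ is $k$. For $\pi\in\Pi$ and a directed path $\vec P=(\vec e_1,\dots,\vec e_k)$, $\phi(\pi,\vec P)\in\Pi$ is the permutation $\sigma$ with $\sigma(e_i)=\pi(e_{i+1})$ for $1\le i<k$, $\sigma(e_k)=\pi(e_1)$, and $\sigma(f)=\pi(f)$ for every edge $f$ not on $\vec P$. -}

module Defs where

open import Data.Nat using (ℕ; zero; suc)
open import Data.Fin using (Fin; _≟_; _<?_)
open import Data.Fin.Permutation using (Permutation′; _⟨$⟩ʳ_; _⟨$⟩ˡ_) public
open import Data.Product using (Σ; ∃; _×_; _,_; proj₁; proj₂)
open import Data.Sum using (_⊎_)
open import Data.Bool using (Bool; true; false; if_then_else_)
open import Data.Maybe using (Maybe; just; nothing; maybe)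
import Data.Maybe as Maybe
open import Data.List using (List; []; _∷_; _++_; [_]; map; mapMaybe; allFin; filter; zip)
open import Relation.Binary.PropositionalEquality using (_≡_; _≢_)
open import Relation.Nullary using (yes; no; does)

SameEnds : ∀ {n} → Fin n × Fin n → Fin n × Fin n → Set
SameEnds (a , b) (c , d) = (a ≡ c × b ≡ d) ⊎ (a ≡ d × b ≡ c)

record SimpleGraph (n m : ℕ) : Set where
  field
    ends     : Fin m → Fin n × Fin n
    loopless : ∀ e → proj₁ (ends e) ≢ proj₂ (ends e)
    simple   : ∀ e f → SameEnds (ends e) (ends f) → e ≡ f
open SimpleGraph public

-- A directed edge: an edge together with its head (the endpoint it points to).
DirEdge : ℕ → ℕ → Set
DirEdge n m = Fin m × Fin n

module _ {n m : ℕ} (G : SimpleGraph n m) (π : Permutation′ m) where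

  otherEnd : Fin m → Fin n → Maybe (Fin n)
  otherEnd e u with does (proj₁ (ends G e) ≟ u) | does (proj₂ (ends G e) ≟ u)
  ... | true  | _     = just (proj₂ (ends G e))
  ... | false | true  = just (proj₁ (ends G e))
  ... | false | false = nothing

  -- all edges, listed in increasing order of rank π
  edgesByRank : List (Fin m)
  edgesByRank = map (π ⟨$⟩ˡ_) (allFin m)

  incident : Fin n → List (DirEdge n m)
  incident u = mapMaybe (λ f → Maybe.map (f ,_) (otherEnd f u)) edgesByRank

  lowerIncident : Fin m → Fin n → List (DirEdge n m)
  lowerIncident e u = filter (λ d → (π ⟨$⟩ʳ proj₁ d) <? (π ⟨$⟩ʳ e)) (incident u)

  -- memo table for EO(e,u,π) (completed calls) and the list of stack snapshots
  Memo : Set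
  Memo = List (DirEdge n m × Bool)

  State : Set
  State = Memo × List (List (DirEdge n m))

  lookupMemo : DirEdge n m → Memo → Maybe Bool
  lookupMemo d [] = nothing
  lookupMemo (e , u) (((f , w) , b) ∷ ms) with does (e ≟ f) | does (u ≟ w)
  ... | true | true = just b
  ... | _    | _    = lookupMemo (e , u) ms

  -- EO(e,u,π) with a fuel bound (the fuel never runs out when started at m,
  -- since ranks strictly decrease along nested calls). The stack is the list
  -- of directed edges (edge, argument vertex) of pending calls; on each call
  -- the new stack content is recorded as a snapshot.
  mutual
    eo : ℕ → List (DirEdge n m) → Fin m → Fin n → State → Bool × State
    eo zero    stack e u s = true , s
    eo (suc k) stack e u (memo , snaps) with lookupMemo (e , u) memo
    ... | just b  = b , (memo , snaps ++ [ stack ++ [ (e , u) ] ])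
    ... | nothing with eoLoop k (stack ++ [ (e , u) ]) (lowerIncident e u)
                           (memo , snaps ++ [ stack ++ [ (e , u) ] ])
    ...   | b , (memo' , snaps') = b , (((e , u) , b) ∷ memo' , snaps')

    eoLoop : ℕ → List (DirEdge n m) → List (DirEdge n m) → State → Bool × State
    eoLoop k stack [] s = true , s
    eoLoop k stack ((f , w) ∷ ds) s with eo k stack f w s
    ... | true  , s' = false , s'
    ... | false , s' = eoLoop k stack ds s'

  voLoop : List (DirEdge n m) → State → Bool × State
  voLoop [] s = false , s
  voLoop ((f , w) ∷ ds) s with eo m [] f w s
  ... | true  , s' = true , s'
  ... | false , s' = voLoop ds s'

  -- the (v,π)-query-paths: all stack contents occurring during VO(v,π)
  -- (the empty stack is included too, as the initial content)
  queryPaths : Fin n → List (List (DirEdge n m))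
  queryPaths v = [] ∷ proj₂ (proj₂ (voLoop (incident v) ([] , [])))

-- φ(π,P): σ(e_i) = π(e_{i+1}), σ(e_k) = π(e_1), σ(f) = π(f) off the path
rotate : ∀ {A : Set} → List A → List A
rotate []       = []
rotate (x ∷ xs) = xs ++ [ x ]

assoc : ∀ {m} → List (Fin m × Fin m) → Fin m → Maybe (Fin m)
assoc [] f = nothing
assoc ((g , h) ∷ xs) f = if does (f ≟ g) then just h else assoc xs f

phi : ∀ {n m} → Permutation′ m → List (DirEdge n m) → Fin m → Fin m
phi π P f =
  let es = map proj₁ P in
  maybe (π ⟨$⟩ʳ_) (π ⟨$⟩ʳ f) (assoc (zip es (rotate es)) f)

LastIs : ∀ {A : Set} → List A → A → Set
LastIs {A} P d = Σ (List A) (λ Q → P ≡ Q ++ [ d ])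

{-# OPTIONS --safe #-}
-- Write P = Q ∷ʳ (x , a) ∷ʳ (e , b) and σ = φ(π,P). The rotation σ moves only edges of P, all
-- ranked at least π(e), and gives x the rank π(e); so below σ(x) the edge oracle answers the same
-- under σ as under π. Hence under σ the oracle is true on x (x was reached in the run under π) and
-- false on every edge at a ranked below σ(x). If also σ = φ(π′,P′) with P′ = Q′ ∷ʳ (x′ , a) ∷ʳ (e , b),
-- the same holds for x′, and the one of the two ranked higher by σ would see the other as a lower
-- true edge at a; so x = x′. Undoing the last rotation step gives φ(π, Q ∷ʳ (x , a)) = φ(π′, Q′ ∷ʳ (x , a)),
-- and induction on the common length ends at φ(π,[e]) = π, forcing π = π′.
module Submission where

open import Defs
open import Data.Nat as ℕ using (ℕ; zero; suc; _<_; _≤_; s≤s)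
import Data.Nat.Properties as ℕ
open import Data.Fin as Fin using (Fin; toℕ; _≟_)
open import Data.Fin.Properties using (toℕ<n; toℕ-injective)
open import Data.Bool using (Bool; true; false; not; _∧_)
open import Data.Maybe using (Maybe; just; nothing; maybe; fromMaybe)
import Data.Maybe as Maybe
open import Data.Maybe.Properties using (just-injective)
open import Data.Product using (∃; ∃₂; _×_; _,_; proj₁; proj₂)
open import Data.Sum using (_⊎_; inj₁; inj₂)
open import Data.List using (List; []; _∷_; _++_; [_]; _∷ʳ_; allFin; map; mapMaybe; zip; length)
open import Data.Bool.ListAction using (any; or)
import Data.List.Properties as List
open import Data.List.Membership.Propositional using (_∈_; _∉_)
open import Data.List.Membership.Propositional.Properties
  using (∈-allFin; ∈-map⁺; ∈-++⁺ˡ; ∈-++⁺ʳ; ∈-++⁻; ∈-filter⁺; ∈-filter⁻)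
open import Data.List.Relation.Unary.All as All using (All; []; _∷_)
import Data.List.Relation.Unary.All.Properties as All
open import Data.List.Relation.Unary.AllPairs using (AllPairs; []; _∷_)
import Data.List.Relation.Unary.AllPairs.Properties as AllPairs
open import Data.List.Relation.Unary.Any using (here; there)
open import Data.Empty using (⊥-elim)
open import Relation.Binary.PropositionalEquality hiding ([_])
open import Relation.Nullary using (yes; no; ¬_)
open import Relation.Binary.Definitions using (tri<; tri≈; tri>)
open import Relation.Nullary.Reflects using (ofʸ; ofⁿ)
import Data.Fin.Permutation as Perm
import Data.List.Membership.DecPropositional as DecMembership
open import Data.Fin.Permutation.Components using (transpose)

any-false : ∀ {A : Set} (p : A → Bool) xs → (∀ x → p x ≡ false) → any p xs ≡ false
any-false p []       h = refl
any-false p (x ∷ xs) h rewrite h x = any-false p xs h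

any-true : ∀ {A : Set} (p : A → Bool) xs {x} → x ∈ xs → p x ≡ true → any p xs ≡ true
any-true p (y ∷ xs) (here refl) px rewrite px = refl
any-true p (y ∷ xs) (there x∈xs) px with p y
... | true  = refl
... | false = any-true p xs x∈xs px

module _ {A B : Set} (p : A → Maybe B) where

  ∈-mapMaybe⁻ : ∀ xs {y} → y ∈ mapMaybe p xs → ∃ λ x → x ∈ xs × p x ≡ just y
  ∈-mapMaybe⁻ (x ∷ xs) y∈ with p x in px
  ∈-mapMaybe⁻ (x ∷ xs) y∈          | nothing = let (z , z∈ , pz) = ∈-mapMaybe⁻ xs y∈ in z , there z∈ , pz
  ∈-mapMaybe⁻ (x ∷ xs) (here refl) | just _  = x , here refl , px
  ∈-mapMaybe⁻ (x ∷ xs) (there y∈)  | just _  = let (z , z∈ , pz) = ∈-mapMaybe⁻ xs y∈ in z , there z∈ , pz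

  ∈-mapMaybe⁺ : ∀ xs {x y} → x ∈ xs → p x ≡ just y → y ∈ mapMaybe p xs
  ∈-mapMaybe⁺ (x ∷ xs) (here refl) px rewrite px = here refl
  ∈-mapMaybe⁺ (z ∷ xs) (there x∈) px with p z
  ... | nothing = ∈-mapMaybe⁺ xs x∈ px
  ... | just _  = there (∈-mapMaybe⁺ xs x∈ px)

  AllPairs-mapMaybe⁺ : ∀ {R : A → A → Set} {S : B → B → Set} →
                       (∀ {x x′ y y′} → p x ≡ just y → p x′ ≡ just y′ → R x x′ → S y y′) →
                       ∀ {xs} → AllPairs R xs → AllPairs S (mapMaybe p xs)
  AllPairs-mapMaybe⁺ h {[]} [] = []
  AllPairs-mapMaybe⁺ {S = S} h {x ∷ xs} (Rx ∷ Rxs) with p x in px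
  ... | nothing = AllPairs-mapMaybe⁺ h Rxs
  ... | just y  = All.tabulate related ∷ AllPairs-mapMaybe⁺ h Rxs
    where
    related : ∀ {y′} → y′ ∈ mapMaybe p xs → S y y′
    related y′∈ = let (x′ , x′∈ , px′) = ∈-mapMaybe⁻ xs y′∈ in h px px′ (All.lookup Rx x′∈)

true≢false : true ≢ false
true≢false ()

length-∷ʳ : ∀ {A : Set} (xs : List A) x → length (xs ∷ʳ x) ≡ suc (length xs)
length-∷ʳ xs x = trans (List.length-++ xs) (ℕ.+-comm (length xs) 1)

length-∷ʳ-cancel : ∀ {A : Set} (xs ys : List A) {x y} →
                   length (xs ∷ʳ x) ≡ length (ys ∷ʳ y) → length xs ≡ length ys
length-∷ʳ-cancel xs ys len = ℕ.suc-injective (trans (sym (length-∷ʳ xs _)) (trans len (length-∷ʳ ys _)))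

⟨$⟩ʳ-injective : ∀ {m} (π : Permutation′ m) {f g} → π ⟨$⟩ʳ f ≡ π ⟨$⟩ʳ g → f ≡ g
⟨$⟩ʳ-injective π eq = trans (sym (Perm.inverseˡ π)) (trans (cong (π ⟨$⟩ˡ_) eq) (Perm.inverseˡ π))

module Endpoints {n m : ℕ} (G : SimpleGraph n m) where

  across : Fin m → Fin n → Maybe (Fin n)
  across = otherEnd G Perm.id

  otherEnd≡across : ∀ (π : Permutation′ m) e u → otherEnd G π e u ≡ across e u
  otherEnd≡across π e u with proj₁ (ends G e) ≟ u | proj₂ (ends G e) ≟ u
  ... | yes _ | _     = refl
  ... | no _  | yes _ = refl
  ... | no _  | no _  = refl

  across-spec : ∀ {e u w} → across e u ≡ just w →
                (proj₁ (ends G e) ≡ u × w ≡ proj₂ (ends G e)) ⊎ (proj₂ (ends G e) ≡ u × w ≡ proj₁ (ends G e))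
  across-spec {e} {u} eq with proj₁ (ends G e) ≟ u | proj₂ (ends G e) ≟ u | eq
  ... | yes s≡u | _     | refl = inj₁ (s≡u , refl)
  ... | no _    | yes t≡u | refl = inj₂ (t≡u , refl)

  across-from₁ : ∀ e → across e (proj₁ (ends G e)) ≡ just (proj₂ (ends G e))
  across-from₁ e with proj₁ (ends G e) ≟ proj₁ (ends G e)
  ... | yes _ = refl
  ... | no s≢s = ⊥-elim (s≢s refl)

  across-from₂ : ∀ e → across e (proj₂ (ends G e)) ≡ just (proj₁ (ends G e))
  across-from₂ e with proj₁ (ends G e) ≟ proj₂ (ends G e) | proj₂ (ends G e) ≟ proj₂ (ends G e)
  ... | yes s≡t | _     = ⊥-elim (loopless G e s≡t)
  ... | no _    | yes _ = refl
  ... | no _    | no t≢t = ⊥-elim (t≢t refl)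

  across-sym : ∀ {e u w} → across e u ≡ just w → across e w ≡ just u
  across-sym {e} eq with across-spec eq
  ... | inj₁ (refl , refl) = across-from₂ e
  ... | inj₂ (refl , refl) = across-from₁ e

  across-injective : ∀ {e u u′ w} → across e u ≡ just w → across e u′ ≡ just w → u ≡ u′
  across-injective eq eq′ = just-injective (trans (sym (across-sym eq)) (across-sym eq′))

Ranking : ℕ → Set
Ranking m = Fin m → ℕ

ranking : ∀ {m} → (Fin m → Fin m) → Ranking m
ranking σ f = toℕ (σ f)

rankOf : ∀ {m} → Permutation′ m → Ranking m
rankOf π = ranking (π ⟨$⟩ʳ_)

AgreeBelow : ∀ {m} → ℕ → Ranking m → Ranking m → Set
AgreeBelow r ρ ρ′ = ∀ g → ρ g < r ⊎ ρ′ g < r → ρ g ≡ ρ′ g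

module OracleValue {n m : ℕ} (G : SimpleGraph n m) where
  open Endpoints G

  lowerTrue : Ranking m → (Fin m → Fin n → Bool) → Fin m → Fin n → Fin m → Bool
  lowerTrue ρ value f u g = (ρ g ℕ.<ᵇ ρ f) ∧ maybe (value g) false (across g u)

  eoValueWithin : Ranking m → ℕ → Fin m → Fin n → Bool
  eoValueWithin ρ zero    f u = true
  eoValueWithin ρ (suc k) f u = not (any (lowerTrue ρ (eoValueWithin ρ k) f u) (allFin m))

  -- EO(f,u) of the paper under the ranking ρ; fuel ρ f + 1 suffices since ranks drop along nested calls.
  eoValue : Ranking m → Fin m → Fin n → Bool
  eoValue ρ f u = eoValueWithin ρ (suc (ρ f)) f u

  AllLowerFalse : Ranking m → Fin n → Fin m → Set
  AllLowerFalse ρ u f = ∀ {g w} → across g u ≡ just w → ρ g < ρ f → eoValue ρ g w ≡ false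

  eoValueWithin-agree : ∀ {r ρ ρ′} → AgreeBelow r ρ ρ′ → ∀ {k k′ f} u →
                        ρ f < r → ρ f < k → ρ f < k′ → eoValueWithin ρ k f u ≡ eoValueWithin ρ′ k′ f u
  eoValueWithin-agree {r} {ρ} {ρ′} agree {suc k} {suc k′} {f} u f<r (s≤s f≤k) (s≤s f≤k′) =
    cong (λ bs → not (or bs)) (List.map-cong lower≡ (allFin m))
    where
    ρf≡ : ρ f ≡ ρ′ f
    ρf≡ = agree f (inj₁ f<r)
    lower≡ : ∀ g → lowerTrue ρ (eoValueWithin ρ k) f u g ≡ lowerTrue ρ′ (eoValueWithin ρ′ k′) f u g
    lower≡ g with ρ g ℕ.<ᵇ ρ f | ℕ.<ᵇ-reflects-< (ρ g) (ρ f) | ρ′ g ℕ.<ᵇ ρ′ f | ℕ.<ᵇ-reflects-< (ρ′ g) (ρ′ f)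
    ... | false | _ | false | _ = refl
    ... | true | ofʸ g<f | false | ofⁿ g≮f = ⊥-elim (g≮f (subst₂ _<_ (agree g (inj₁ (ℕ.<-trans g<f f<r))) ρf≡ g<f))
    ... | false | ofⁿ g≮f | true | ofʸ g<f =
      ⊥-elim (g≮f (subst₂ _<_ (sym (agree g (inj₂ (ℕ.<-trans g<f (subst (_< r) ρf≡ f<r))))) (sym ρf≡) g<f))
    ... | true | ofʸ g<f | true | _ with across g u
    ...   | nothing = refl
    ...   | just w  = eoValueWithin-agree agree w (ℕ.<-trans g<f f<r) (ℕ.<-≤-trans g<f f≤k) (ℕ.<-≤-trans g<f f≤k′)

  eoValue-agree : ∀ {r ρ ρ′} → AgreeBelow r ρ ρ′ → ∀ {f} u → ρ f < r → eoValue ρ f u ≡ eoValue ρ′ f u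
  eoValue-agree agree {f} u f<r =
    eoValueWithin-agree agree u f<r (ℕ.n<1+n _) (s≤s (ℕ.≤-reflexive (agree f (inj₁ f<r))))

  eoValueWithin-fuel : ∀ {ρ k f u} → ρ f < k → eoValueWithin ρ k f u ≡ eoValue ρ f u
  eoValueWithin-fuel {u = u} f<k = eoValueWithin-agree (λ _ _ → refl) u f<k f<k (ℕ.n<1+n _)

  eoValue-true⁺ : ∀ {ρ f u} → AllLowerFalse ρ u f → eoValue ρ f u ≡ true
  eoValue-true⁺ {ρ} {f} {u} low = cong not (any-false _ (allFin m) lower)
    where
    lower : ∀ g → lowerTrue ρ (eoValueWithin ρ (ρ f)) f u g ≡ false
    lower g with ρ g ℕ.<ᵇ ρ f | ℕ.<ᵇ-reflects-< (ρ g) (ρ f) | across g u in eq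
    ... | false | _       | _       = refl
    ... | true  | _       | nothing = refl
    ... | true  | ofʸ g<f | just w  = trans (eoValueWithin-fuel g<f) (low eq g<f)

  eoValue-false⁺ : ∀ {ρ f u g w} → across g u ≡ just w → ρ g < ρ f → eoValue ρ g w ≡ true → eoValue ρ f u ≡ false
  eoValue-false⁺ {ρ} {f} {u} {g} {w} eq g<f t = cong not (any-true _ (allFin m) (∈-allFin g) lower)
    where
    lower : lowerTrue ρ (eoValueWithin ρ (ρ f)) f u g ≡ true
    lower with ρ g ℕ.<ᵇ ρ f | ℕ.<ᵇ-reflects-< (ρ g) (ρ f)
    ... | false | ofⁿ g≮f = ⊥-elim (g≮f g<f)
    ... | true  | _ rewrite eq = trans (eoValueWithin-fuel g<f) t

module QueryPaths {n m : ℕ} (G : SimpleGraph n m) where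
  open Endpoints G
  open OracleValue G

  -- QueryPath ρ v Q d: the stack Q ∷ʳ d can occur during VO(v) under the ranking ρ.
  data QueryPath (ρ : Ranking m) (v : Fin n) : List (DirEdge n m) → DirEdge n m → Set where
    start  : ∀ {x a} → across x v ≡ just a → AllLowerFalse ρ v x → QueryPath ρ v [] (x , a)
    extend : ∀ {Q x a e b} → QueryPath ρ v Q (x , a) →
             across e a ≡ just b → ρ e < ρ x → AllLowerFalse ρ a e → QueryPath ρ v (Q ∷ʳ (x , a)) (e , b)

  QueryPath-ranks : ∀ {ρ v Q x a} → QueryPath ρ v Q (x , a) → ∀ {g} → g ∈ map proj₁ Q → ρ x < ρ g
  QueryPath-ranks (extend {Q} {y} {c} q _ e<y _) g∈
    with ∈-++⁻ (map proj₁ Q) (subst (_ ∈_) (List.map-++ proj₁ Q [ (y , c) ]) g∈)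
  ... | inj₁ g∈Q         = ℕ.<-trans e<y (QueryPath-ranks q g∈Q)
  ... | inj₂ (here refl) = e<y

  QueryPath-tail : ∀ {ρ v Q x a} → QueryPath ρ v Q (x , a) → ∃ λ c → across x c ≡ just a × AllLowerFalse ρ c x
  QueryPath-tail {v = v} (start o low)      = v , o , low
  QueryPath-tail (extend {a = c} _ o _ low) = c , o , low

module Execution {n m : ℕ} (G : SimpleGraph n m) (π : Permutation′ m) where
  open Endpoints G
  open OracleValue G
  open QueryPaths G

  ρ : Ranking m
  ρ = rankOf π

  Sorted : List (DirEdge n m) → Set
  Sorted = AllPairs (λ d d′ → ρ (proj₁ d) < ρ (proj₁ d′))

  edgesByRank-sorted : AllPairs (λ f g → ρ f < ρ g) (edgesByRank G π)
  edgesByRank-sorted =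
    AllPairs.map⁺ (AllPairs.tabulate⁺-< (subst₂ (λ i j → toℕ i < toℕ j) (sym (Perm.inverseʳ π)) (sym (Perm.inverseʳ π))))

  edgesByRank-complete : ∀ g → g ∈ edgesByRank G π
  edgesByRank-complete g = subst (_∈ edgesByRank G π) (Perm.inverseˡ π) (∈-map⁺ (π ⟨$⟩ˡ_) (∈-allFin (π ⟨$⟩ʳ g)))

  incidentEntry : Fin n → Fin m → Maybe (DirEdge n m)
  incidentEntry u f = Maybe.map (f ,_) (otherEnd G π f u)

  incidentEntry-just : ∀ {u f d} → incidentEntry u f ≡ just d → proj₁ d ≡ f × across f u ≡ just (proj₂ d)
  incidentEntry-just {u} {f} eq with otherEnd G π f u in o | eq
  ... | just w | refl = refl , trans (sym (otherEnd≡across π f u)) o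

  incident-sound : ∀ {u d} → d ∈ incident G π u → across (proj₁ d) u ≡ just (proj₂ d)
  incident-sound d∈ with ∈-mapMaybe⁻ (incidentEntry _) (edgesByRank G π) d∈
  ... | f , _ , eq with incidentEntry-just eq
  ...   | refl , o = o

  incident-complete : ∀ {u g w} → across g u ≡ just w → (g , w) ∈ incident G π u
  incident-complete {u} {g} o = ∈-mapMaybe⁺ (incidentEntry u) (edgesByRank G π) (edgesByRank-complete g)
                                  (cong (Maybe.map (g ,_)) (trans (otherEnd≡across π g u) o))

  incident-sorted : ∀ u → Sorted (incident G π u)
  incident-sorted u = AllPairs-mapMaybe⁺ (incidentEntry u) ranks edgesByRank-sorted
    where
    ranks : ∀ {f f′ d d′} → incidentEntry u f ≡ just d → incidentEntry u f′ ≡ just d′ → ρ f < ρ f′ → ρ (proj₁ d) < ρ (proj₁ d′)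
    ranks eq eq′ with incidentEntry-just eq | incidentEntry-just eq′
    ... | refl , _ | refl , _ = λ f<f′ → f<f′

  lowerIncident-sound : ∀ {e u d} → d ∈ lowerIncident G π e u → across (proj₁ d) u ≡ just (proj₂ d) × ρ (proj₁ d) < ρ e
  lowerIncident-sound {e} d∈ with ∈-filter⁻ (λ d → (π ⟨$⟩ʳ proj₁ d) Fin.<? (π ⟨$⟩ʳ e)) d∈
  ... | d∈inc , d<e = incident-sound d∈inc , d<e

  lowerIncident-complete : ∀ {e u g w} → across g u ≡ just w → ρ g < ρ e → (g , w) ∈ lowerIncident G π e u
  lowerIncident-complete {e} o g<e = ∈-filter⁺ (λ d → (π ⟨$⟩ʳ proj₁ d) Fin.<? (π ⟨$⟩ʳ e)) (incident-complete o) g<e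

  lowerIncident-sorted : ∀ e u → Sorted (lowerIncident G π e u)
  lowerIncident-sorted e u = AllPairs.filter⁺ _ (incident-sorted u)

  IsFalse : DirEdge n m → Set
  IsFalse (f , w) = eoValue ρ f w ≡ false

  sorted-prefix : ∀ pre {d ds y} → Sorted (pre ++ d ∷ ds) → y ∈ pre ++ d ∷ ds → ρ (proj₁ y) < ρ (proj₁ d) → y ∈ pre
  sorted-prefix []        s                (here refl) y<d = ⊥-elim (ℕ.<-irrefl refl y<d)
  sorted-prefix []        (d<ds ∷ _)       (there y∈)  y<d = ⊥-elim (ℕ.<-asym y<d (All.lookup d<ds y∈))
  sorted-prefix (p ∷ pre) s                (here refl) y<d = here refl
  sorted-prefix (p ∷ pre) (_ ∷ s)          (there y∈)  y<d = there (sorted-prefix pre s y∈ y<d)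

  -- The loops scan edges in increasing rank and stop at the first true answer,
  -- so an edge is reached only when every lower edge of the scanned list was false.
  reached-AllLowerFalse : ∀ {u f w pre ds L} → pre ++ (f , w) ∷ ds ≡ L → Sorted L →
                          (∀ {g w′} → across g u ≡ just w′ → ρ g < ρ f → (g , w′) ∈ L) →
                          All IsFalse pre → AllLowerFalse ρ u f
  reached-AllLowerFalse {pre = pre} refl sorted lower∈ pre-false o g<f =
    All.lookup pre-false (sorted-prefix pre sorted (lower∈ o g<f) g<f)

  module _ (v : Fin n) where

    IsStack : List (DirEdge n m) → Set
    IsStack P = ∃₂ λ Q d → P ≡ Q ∷ʳ d × QueryPath ρ v Q d

    MemoCorrect : DirEdge n m × Bool → Set
    MemoCorrect ((f , w) , b) = b ≡ eoValue ρ f w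

    Invariant : State G π → Set
    Invariant s = All MemoCorrect (proj₁ s) × All IsStack (proj₂ s)

    Correct : Fin m → Fin n → Bool × State G π → Set
    Correct e u r = proj₁ r ≡ eoValue ρ e u × Invariant (proj₂ r)

    lookupMemo-sound : ∀ {e u b} memo → lookupMemo G π (e , u) memo ≡ just b → All MemoCorrect memo → b ≡ eoValue ρ e u
    lookupMemo-sound {e} {u} (((f , w) , b′) ∷ memo) found (b′≡ ∷ rest) with e ≟ f | u ≟ w | found
    ... | yes refl | yes refl | refl = b′≡
    ... | yes _    | no _     | found′ = lookupMemo-sound memo found′ rest
    ... | no _     | _        | found′ = lookupMemo-sound memo found′ rest

    record-call : ∀ {stack e u memo snaps} → Invariant (memo , snaps) → QueryPath ρ v stack (e , u) →
                  Invariant (memo , snaps ++ [ stack ∷ʳ (e , u) ])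
    record-call (memo-ok , snaps-ok) q = memo-ok , All.++⁺ snaps-ok ((_ , _ , refl , q) ∷ [])

    mutual
      eo-correct : ∀ k stack e u s → ρ e < k → Invariant s → QueryPath ρ v stack (e , u) →
                   Correct e u (eo G π k stack e u s)
      eo-correct (suc k) stack e u (memo , snaps) (s≤s e≤k) inv q with lookupMemo G π (e , u) memo in found
      ... | just b  = lookupMemo-sound memo found (proj₁ inv) , record-call inv q
      ... | nothing with eoLoop G π k (stack ∷ʳ (e , u)) (lowerIncident G π e u) (memo , snaps ++ [ stack ∷ʳ (e , u) ])
                       | loop-correct k stack e u [] (lowerIncident G π e u) _ refl [] (record-call inv q) q e≤k
      ...   | b , _ | b≡ , memo-ok , snaps-ok = b≡ , (b≡ ∷ memo-ok) , snaps-ok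

      loop-correct : ∀ k stack e u pre ds s → pre ++ ds ≡ lowerIncident G π e u → All IsFalse pre →
                     Invariant s → QueryPath ρ v stack (e , u) → ρ e ≤ k →
                     Correct e u (eoLoop G π k (stack ∷ʳ (e , u)) ds s)
      loop-correct k stack e u pre [] s pre≡ pre-false inv q e≤k =
        sym (eoValue-true⁺ {ρ = ρ} λ o g<e → All.lookup pre-false
          (subst (_ ∈_) (trans (sym pre≡) (List.++-identityʳ pre)) (lowerIncident-complete o g<e))) , inv
      loop-correct k stack e u pre ((f , w) ∷ ds) s pre≡ pre-false inv q e≤k
        with lowerIncident-sound (subst ((f , w) ∈_) pre≡ (∈-++⁺ʳ pre (here refl)))
      ... | o , f<e
        with eo G π k (stack ∷ʳ (e , u)) f w s
           | eo-correct k (stack ∷ʳ (e , u)) f w s (ℕ.<-≤-trans f<e e≤k) inv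
               (extend q o f<e (reached-AllLowerFalse pre≡ (lowerIncident-sorted e u)
                 (λ o′ g<f → lowerIncident-complete o′ (ℕ.<-trans g<f f<e)) pre-false))
      ...   | true  , _  | t , inv′ = sym (eoValue-false⁺ {ρ = ρ} o f<e (sym t)) , inv′
      ...   | false , s′ | t , inv′ =
              loop-correct k stack e u (pre ∷ʳ (f , w)) ds s′ (trans (List.++-assoc pre _ ds) pre≡)
                (All.++⁺ pre-false (sym t ∷ [])) inv′ q e≤k

    vo-correct : ∀ pre ds s → pre ++ ds ≡ incident G π v → All IsFalse pre → Invariant s →
                 Invariant (proj₂ (voLoop G π ds s))
    vo-correct pre [] s pre≡ pre-false inv = inv
    vo-correct pre ((f , w) ∷ ds) s pre≡ pre-false inv
      with eo G π m [] f w s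
         | eo-correct m [] f w s (toℕ<n (π ⟨$⟩ʳ f)) inv
             (start (incident-sound (subst ((f , w) ∈_) pre≡ (∈-++⁺ʳ pre (here refl))))
                    (reached-AllLowerFalse pre≡ (incident-sorted v) (λ o _ → incident-complete o) pre-false))
    ... | true  , _  | _ , inv′ = inv′
    ... | false , s′ | t , inv′ =
          vo-correct (pre ∷ʳ (f , w)) ds s′ (trans (List.++-assoc pre _ ds) pre≡) (All.++⁺ pre-false (sym t ∷ [])) inv′

    queryPaths-sound : ∀ {Q d} → Q ∷ʳ d ∈ queryPaths G π v → QueryPath ρ v Q d
    queryPaths-sound {[]}    (here ())
    queryPaths-sound {_ ∷ _} (here ())
    queryPaths-sound {Q} (there P∈)
      with All.lookup (proj₂ (vo-correct [] (incident G π v) ([] , []) refl [] ([] , []))) P∈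
    ... | Q′ , d′ , P≡ , q with List.∷ʳ-injective Q Q′ P≡
    ...   | refl , refl = q

module Rotation {m : ℕ} where

  cycle : List (Fin m) → Fin m → Fin m
  cycle es f = fromMaybe f (assoc (zip es (rotate es)) f)

  phi-cycle : ∀ {n} (π : Permutation′ m) (P : List (DirEdge n m)) f → phi π P f ≡ π ⟨$⟩ʳ cycle (map proj₁ P) f
  phi-cycle π P f with assoc (zip (map proj₁ P) (rotate (map proj₁ P))) f
  ... | just _  = refl
  ... | nothing = refl

  cycle-singleton : ∀ e f → cycle [ e ] f ≡ f
  cycle-singleton e f with f ≟ e
  ... | yes refl = refl
  ... | no _     = refl

  assoc-∈ : ∀ (A : List (Fin m × Fin m)) {g h} → assoc A g ≡ just h → (g , h) ∈ A
  assoc-∈ ((k , h′) ∷ A) {g} found with g ≟ k | found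
  ... | yes refl | refl   = here refl
  ... | no _     | found′ = there (assoc-∈ A found′)

  assoc-++-just : ∀ (A B : List (Fin m × Fin m)) {g h} → assoc A g ≡ just h → assoc (A ++ B) g ≡ just h
  assoc-++-just ((k , h′) ∷ A) B {g} found with g ≟ k
  ... | yes _ = found
  ... | no _  = assoc-++-just A B found

  assoc-++-nothing : ∀ (A B : List (Fin m × Fin m)) {g} → assoc A g ≡ nothing → assoc (A ++ B) g ≡ assoc B g
  assoc-++-nothing []            B none = refl
  assoc-++-nothing ((k , h′) ∷ A) B {g} none with g ≟ k | none
  ... | no _ | none′ = assoc-++-nothing A B none′

  assoc-∉ : ∀ (A : List (Fin m × Fin m)) {g} → g ∉ map proj₁ A → assoc A g ≡ nothing
  assoc-∉ []            g∉ = refl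
  assoc-∉ ((k , h′) ∷ A) {g} g∉ with g ≟ k
  ... | yes refl = ⊥-elim (g∉ (here refl))
  ... | no _     = assoc-∉ A (λ g∈ → g∉ (there g∈))

  headOr : List (Fin m) → Fin m → Fin m
  headOr []      x = x
  headOr (y ∷ _) x = y

  successors : List (Fin m) → Fin m → List (Fin m × Fin m)
  successors []       x = []
  successors (y ∷ ys) x = (y , headOr ys x) ∷ successors ys x

  successors-keys : ∀ l x → map proj₁ (successors l x) ≡ l
  successors-keys []      x = refl
  successors-keys (y ∷ l) x = cong (y ∷_) (successors-keys l x)

  successors-values : ∀ l x {g h} → (g , h) ∈ successors l x → h ∈ l ∷ʳ x
  successors-values (y ∷ [])    x (here refl) = there (here refl)
  successors-values (y ∷ z ∷ l) x (here refl) = there (here refl)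
  successors-values (y ∷ l)     x (there gh∈) = there (successors-values l x gh∈)

  successors-∷ʳ : ∀ l x e → successors (l ∷ʳ x) e ≡ successors l x ∷ʳ (x , e)
  successors-∷ʳ []          x e = refl
  successors-∷ʳ (y ∷ [])    x e = refl
  successors-∷ʳ (y ∷ z ∷ l) x e = cong ((y , z) ∷_) (successors-∷ʳ (z ∷ l) x e)

  zip-∷-∷ʳ : ∀ y ys x z → zip (y ∷ ys ∷ʳ x) (ys ∷ʳ x ∷ʳ z) ≡ successors (y ∷ ys) x ∷ʳ (x , z)
  zip-∷-∷ʳ y []       x z = refl
  zip-∷-∷ʳ y (w ∷ ws) x z = cong ((y , w) ∷_) (zip-∷-∷ʳ w ws x z)

  zip-rotate : ∀ l x → zip (l ∷ʳ x) (rotate (l ∷ʳ x)) ≡ successors l x ∷ʳ (x , headOr l x)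
  zip-rotate []      x = refl
  zip-rotate (y ∷ l) x = zip-∷-∷ʳ y l x y

  headOr-∈ : ∀ l x → headOr l x ∈ l ∷ʳ x
  headOr-∈ []      x = here refl
  headOr-∈ (y ∷ l) x = here refl

  headOr-∷ʳ : ∀ l x e → headOr (l ∷ʳ x) e ≡ headOr l x
  headOr-∷ʳ []      x e = refl
  headOr-∷ʳ (y ∷ l) x e = refl

  module Extension (l : List (Fin m)) (x e : Fin m) (x∉l : x ∉ l) (e∉lx : e ∉ l ∷ʳ x) where

    lx es : List (Fin m)
    lx = l ∷ʳ x
    es = lx ∷ʳ e

    A : List (Fin m × Fin m)
    A = successors l x

    h₀ : Fin m
    h₀ = headOr l x

    cycle-lx : ∀ g → cycle lx g ≡ fromMaybe g (assoc (A ++ [ (x , h₀) ]) g)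
    cycle-lx g = cong (λ Z → fromMaybe g (assoc Z g)) (zip-rotate l x)

    cycle-es : ∀ g → cycle es g ≡ fromMaybe g (assoc (A ++ (x , e) ∷ (e , h₀) ∷ []) g)
    cycle-es g = cong (λ Z → fromMaybe g (assoc Z g)) (begin
      zip es (rotate es)                  ≡⟨ zip-rotate lx e ⟩
      successors lx e ∷ʳ (e , headOr lx e) ≡⟨ cong₂ (λ B h → B ∷ʳ (e , h)) (successors-∷ʳ l x e) (headOr-∷ʳ l x e) ⟩
      A ∷ʳ (x , e) ∷ʳ (e , h₀)            ≡⟨ List.++-assoc A _ _ ⟩
      A ++ (x , e) ∷ (e , h₀) ∷ []        ∎)
      where open ≡-Reasoning

    x≢e : x ≢ e
    x≢e refl = e∉lx (∈-++⁺ʳ l (here refl))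

    e∉l : e ∉ l
    e∉l e∈ = e∉lx (∈-++⁺ˡ e∈)

    B₁ B₂ : List (Fin m × Fin m)
    B₁ = [ (x , h₀) ]
    B₂ = (x , e) ∷ (e , h₀) ∷ []

    in-l : ∀ {g h} B → assoc A g ≡ just h → fromMaybe g (assoc (A ++ B) g) ≡ h
    in-l {g} B found = cong (fromMaybe g) (assoc-++-just A B found)

    off-l : ∀ {g} B → assoc A g ≡ nothing → fromMaybe g (assoc (A ++ B) g) ≡ fromMaybe g (assoc B g)
    off-l {g} B none = cong (fromMaybe g) (assoc-++-nothing A B none)

    A-nothing : ∀ {g} → g ∉ l → assoc A g ≡ nothing
    A-nothing g∉l = assoc-∉ A (subst (_ ∉_) (sym (successors-keys l x)) g∉l)

    A-value : ∀ {g h} → assoc A g ≡ just h → h ∈ lx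
    A-value found = successors-values l x (assoc-∈ A found)

    cycle-x : cycle es x ≡ e
    cycle-x rewrite cycle-es x | off-l B₂ (A-nothing x∉l) with x ≟ x
    ... | yes _  = refl
    ... | no x≢x = ⊥-elim (x≢x refl)

    cycle-∉ : ∀ {g} → g ∉ es → cycle es g ≡ g
    cycle-∉ {g} g∉ rewrite cycle-es g | off-l B₂ (A-nothing {g} (λ g∈ → g∉ (∈-++⁺ˡ (∈-++⁺ˡ g∈)))) with g ≟ x
    ... | yes refl = ⊥-elim (g∉ (∈-++⁺ˡ (∈-++⁺ʳ l (here refl))))
    ... | no _ with g ≟ e
    ...   | yes refl = ⊥-elim (g∉ (∈-++⁺ʳ lx (here refl)))
    ...   | no _     = refl

    cycle-∈ : ∀ {g} → g ∈ es → cycle es g ∈ es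
    cycle-∈ {g} g∈ rewrite cycle-es g with assoc A g in found
    ... | just h  rewrite in-l B₂ found = ∈-++⁺ˡ (A-value found)
    ... | nothing rewrite off-l B₂ found with g ≟ x
    ...   | yes _ = ∈-++⁺ʳ lx (here refl)
    ...   | no _ with g ≟ e
    ...     | yes _ = ∈-++⁺ˡ (headOr-∈ l x)
    ...     | no _  = g∈

    cycle-≡e : ∀ {g} → cycle es g ≡ e → g ≡ x
    cycle-≡e {g} hit rewrite cycle-es g with assoc A g in found
    ... | just h  rewrite in-l B₂ found = ⊥-elim (e∉lx (subst (_∈ lx) hit (A-value found)))
    ... | nothing rewrite off-l B₂ found with g ≟ x
    ...   | yes g≡x = g≡x
    ...   | no _ with g ≟ e
    ...     | yes _  = ⊥-elim (e∉lx (subst (_∈ lx) hit (headOr-∈ l x)))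
    ...     | no g≢e = ⊥-elim (g≢e hit)

    cycle-transpose : ∀ g → cycle lx g ≡ cycle es (transpose x e g)
    cycle-transpose g with g ≟ x
    cycle-transpose g | yes refl rewrite cycle-lx x | cycle-es e | off-l B₁ (A-nothing x∉l) | off-l B₂ (A-nothing e∉l)
      with x ≟ x | e ≟ x | e ≟ e
    ... | yes _  | no _     | yes _  = refl
    ... | no x≢x | _        | _      = ⊥-elim (x≢x refl)
    ... | _      | yes e≡x  | _      = ⊥-elim (x≢e (sym e≡x))
    ... | _      | _        | no e≢e = ⊥-elim (e≢e refl)
    cycle-transpose g | no g≢x with g ≟ e
    cycle-transpose g | no g≢x | yes refl rewrite cycle-lx e | off-l B₁ (A-nothing e∉l) | cycle-x with e ≟ x
    ... | yes e≡x = ⊥-elim (x≢e (sym e≡x))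
    ... | no _    = refl
    cycle-transpose g | no g≢x | no g≢e rewrite cycle-lx g | cycle-es g with assoc A g in found
    ... | just h  rewrite in-l B₁ found | in-l B₂ found = refl
    ... | nothing rewrite off-l B₁ found | off-l B₂ found with g ≟ x | g ≟ e
    ...   | yes g≡x | _       = ⊥-elim (g≢x g≡x)
    ...   | no _    | yes g≡e = ⊥-elim (g≢e g≡e)
    ...   | no _    | no _    = refl

module LastStep {n m : ℕ} (G : SimpleGraph n m) (π : Permutation′ m)
                {v : Fin n} {Q : List (DirEdge n m)} {x e : Fin m} {a b : Fin n}
                (q : QueryPaths.QueryPath G (rankOf π) v Q (x , a))
                (e<x : rankOf π e < rankOf π x)
                (low : OracleValue.AllLowerFalse G (rankOf π) a e) where
  open Endpoints G
  open OracleValue G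
  open QueryPaths G
  open Rotation
  open DecMembership (_≟_ {m}) using (_∈?_)

  ρ : Ranking m
  ρ = rankOf π

  σ : Fin m → Fin m
  σ = phi π (Q ∷ʳ (x , a) ∷ʳ (e , b))

  x∉Q : x ∉ map proj₁ Q
  x∉Q x∈ = ℕ.<-irrefl refl (QueryPath-ranks q x∈)

  e∉Qx : e ∉ map proj₁ Q ∷ʳ x
  e∉Qx e∈ with ∈-++⁻ (map proj₁ Q) e∈
  ... | inj₁ e∈Q         = ℕ.<-irrefl refl (ℕ.<-trans e<x (QueryPath-ranks q e∈Q))
  ... | inj₂ (here refl) = ℕ.<-irrefl refl e<x

  open Extension (map proj₁ Q) x e x∉Q e∉Qx

  σ-cycle : ∀ f → σ f ≡ π ⟨$⟩ʳ cycle es f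
  σ-cycle f = trans (phi-cycle π (Q ∷ʳ (x , a) ∷ʳ (e , b)) f) (cong (λ ds → π ⟨$⟩ʳ cycle ds f)
    (trans (List.map-++ proj₁ (Q ∷ʳ (x , a)) _) (cong (_∷ʳ e) (List.map-++ proj₁ Q _))))

  σ-x : σ x ≡ π ⟨$⟩ʳ e
  σ-x = trans (σ-cycle x) (cong (π ⟨$⟩ʳ_) cycle-x)

  σ-≡e : ∀ {g} → σ g ≡ π ⟨$⟩ʳ e → g ≡ x
  σ-≡e hit = cycle-≡e (⟨$⟩ʳ-injective π (trans (sym (σ-cycle _)) hit))

  es-above-e : ∀ {g} → g ∈ es → ρ e ≤ ρ g
  es-above-e g∈ with ∈-++⁻ lx g∈
  ... | inj₂ (here refl) = ℕ.≤-refl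
  ... | inj₁ g∈lx with ∈-++⁻ (map proj₁ Q) g∈lx
  ...   | inj₁ g∈Q         = ℕ.<⇒≤ (ℕ.<-trans e<x (QueryPath-ranks q g∈Q))
  ...   | inj₂ (here refl) = ℕ.<⇒≤ e<x

  -- σ moves only edges of the path, all of which rank at least ρ e under both π and σ.
  σ-agrees-below : AgreeBelow (ρ e) (ranking σ) ρ
  σ-agrees-below g below with g ∈? es
  ... | no g∉ = cong toℕ (trans (σ-cycle g) (cong (π ⟨$⟩ʳ_) (cycle-∉ g∉)))
  ... | yes g∈ with below
  ...   | inj₂ g<e = ⊥-elim (ℕ.<⇒≱ g<e (es-above-e g∈))
  ...   | inj₁ g<e = ⊥-elim (ℕ.<⇒≱ g<e (subst (λ h → ρ e ≤ toℕ h) (sym (σ-cycle g)) (es-above-e (cycle-∈ g∈))))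

  below-σx : ∀ {g} → ranking σ g < ranking σ x → ρ g < ρ e × ∀ w → eoValue (ranking σ) g w ≡ eoValue ρ g w
  below-σx {g} g<x = subst (_< ρ e) (σ-agrees-below g (inj₁ g<e)) g<e , λ w → eoValue-agree σ-agrees-below w g<e
    where
    g<e : ranking σ g < ρ e
    g<e = subst (λ h → ranking σ g < toℕ h) σ-x g<x

  x-true : ∀ {c} → across x c ≡ just a → AllLowerFalse ρ c x → eoValue (ranking σ) x c ≡ true
  x-true _ low-x = eoValue-true⁺ λ {g} {w} o g<x →
    let (g<e , same) = below-σx g<x in trans (same w) (low-x o (ℕ.<-trans g<e e<x))

  below-x-false : ∀ {g w} → across g a ≡ just w → ranking σ g < ranking σ x → eoValue (ranking σ) g w ≡ false
  below-x-false {w = w} o g<x = let (g<e , same) = below-σx g<x in trans (same w) (low o g<e)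

  shorten : ∀ f → phi π (Q ∷ʳ (x , a)) f ≡ σ (transpose x e f)
  shorten f = begin
    phi π (Q ∷ʳ (x , a)) f           ≡⟨ phi-cycle π (Q ∷ʳ (x , a)) f ⟩
    π ⟨$⟩ʳ cycle (map proj₁ (Q ∷ʳ (x , a))) f ≡⟨ cong (λ ds → π ⟨$⟩ʳ cycle ds f) (List.map-++ proj₁ Q _) ⟩
    π ⟨$⟩ʳ cycle lx f                ≡⟨ cong (π ⟨$⟩ʳ_) (cycle-transpose f) ⟩
    π ⟨$⟩ʳ cycle es (transpose x e f) ≡⟨ sym (σ-cycle _) ⟩
    σ (transpose x e f)               ∎
    where open ≡-Reasoning

module Reconstruction {n m : ℕ} (G : SimpleGraph n m) (π π′ : Permutation′ m) {v v′ : Fin n} where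
  open Endpoints G
  open OracleValue G
  open QueryPaths G
  open Rotation

  eoValue-ranking-cong : ∀ {σ σ′ : Fin m → Fin m} → (∀ f → σ f ≡ σ′ f) →
                         ∀ f u → eoValue (ranking σ) f u ≡ eoValue (ranking σ′) f u
  eoValue-ranking-cong {σ} same f u = eoValue-agree (λ g _ → cong toℕ (same g)) u (toℕ<n (σ f))

  module TwoSides {Q Q′ : List (DirEdge n m)} {x x′ e : Fin m} {a b : Fin n}
      (q : QueryPath (rankOf π) v Q (x , a)) (q′ : QueryPath (rankOf π′) v′ Q′ (x′ , a))
      (e<x : rankOf π e < rankOf π x) (e<x′ : rankOf π′ e < rankOf π′ x′)
      (low : AllLowerFalse (rankOf π) a e) (low′ : AllLowerFalse (rankOf π′) a e) where
    module S  = LastStep G π  {b = b} q  e<x  low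
    module S′ = LastStep G π′ {b = b} q′ e<x′ low′

    penultimate-unique : (∀ f → S.σ f ≡ S′.σ f) → x′ ≡ x
    penultimate-unique same with QueryPath-tail q | QueryPath-tail q′ | ℕ.<-cmp (ranking S.σ x) (ranking S.σ x′)
    ... | c , o , low-x | _ | tri< x<x′ _ _ = ⊥-elim (true≢false (begin
        true                         ≡⟨ sym (S.x-true o low-x) ⟩
        eoValue (ranking S.σ) x c    ≡⟨ eoValue-ranking-cong same x c ⟩
        eoValue (ranking S′.σ) x c   ≡⟨ S′.below-x-false (across-sym o)
                                          (subst₂ _<_ (cong toℕ (same x)) (cong toℕ (same x′)) x<x′) ⟩
        false                        ∎))
      where open ≡-Reasoning
    ... | _ | c′ , o′ , low-x′ | tri> _ _ x′<x = ⊥-elim (true≢false (begin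
        true                         ≡⟨ sym (S′.x-true o′ low-x′) ⟩
        eoValue (ranking S′.σ) x′ c′ ≡⟨ eoValue-ranking-cong (λ f → sym (same f)) x′ c′ ⟩
        eoValue (ranking S.σ) x′ c′  ≡⟨ S.below-x-false (across-sym o′) x′<x ⟩
        false                        ∎))
      where open ≡-Reasoning
    ... | _ | _ | tri≈ _ x≡x′ _ = S.σ-≡e (trans (sym (toℕ-injective x≡x′)) S.σ-x)

    shorten-both : (∀ f → S.σ f ≡ S′.σ f) → x′ ≡ x → ∀ f → phi π (Q ∷ʳ (x , a)) f ≡ phi π′ (Q′ ∷ʳ (x , a)) f
    shorten-both same refl f = trans (S.shorten f) (trans (same _) (sym (S′.shorten f)))

  ranks-determined : ∀ {Q Q′ d} → QueryPath (rankOf π) v Q d → QueryPath (rankOf π′) v′ Q′ d →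
                     length Q ≡ length Q′ → (∀ f → phi π (Q ∷ʳ d) f ≡ phi π′ (Q′ ∷ʳ d) f) →
                     ∀ f → π ⟨$⟩ʳ f ≡ π′ ⟨$⟩ʳ f
  ranks-determined {d = e , b} (start _ _) (start _ _) _ same f = begin
    π ⟨$⟩ʳ f                  ≡⟨ cong (π ⟨$⟩ʳ_) (sym (cycle-singleton e f)) ⟩
    π ⟨$⟩ʳ cycle [ e ] f      ≡⟨ sym (phi-cycle π [ (e , b) ] f) ⟩
    phi π [ (e , b) ] f       ≡⟨ same f ⟩
    phi π′ [ (e , b) ] f      ≡⟨ phi-cycle π′ [ (e , b) ] f ⟩
    π′ ⟨$⟩ʳ cycle [ e ] f     ≡⟨ cong (π′ ⟨$⟩ʳ_) (cycle-singleton e f) ⟩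
    π′ ⟨$⟩ʳ f                 ∎
    where open ≡-Reasoning
  ranks-determined (start _ _) (extend {Q′} _ _ _ _) len _ = ⊥-elim (ℕ.0≢1+n (trans len (length-∷ʳ Q′ _)))
  ranks-determined (extend {Q} _ _ _ _) (start _ _) len _ = ⊥-elim (ℕ.0≢1+n (trans (sym len) (length-∷ʳ Q _)))
  ranks-determined (extend {Q} q o e<x low) (extend {Q′} q′ o′ e<x′ low′) len same
    with across-injective o o′
  ... | refl with TwoSides.penultimate-unique q q′ e<x e<x′ low low′ same
  ...   | refl = ranks-determined q q′ (length-∷ʳ-cancel Q Q′ len)
                   (TwoSides.shorten-both q q′ e<x e<x′ low low′ same refl)

claim3p14 : ∀ {n m} (G : SimpleGraph n m) (a b : Fin n) (e : Fin m)
            → SameEnds (ends G e) (a , b)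
            → (π π′ : Permutation′ m) → ¬ (∀ f → π ⟨$⟩ʳ f ≡ π′ ⟨$⟩ʳ f)
            → (v v′ : Fin n) (P P′ : List (DirEdge n m))
            → P ∈ queryPaths G π v → P′ ∈ queryPaths G π′ v′
            → LastIs P (e , b) → LastIs P′ (e , b)
            → (∀ f → phi π P f ≡ phi π′ P′ f)
            → length P ≢ length P′
claim3p14 G a b e _ π π′ π≉π′ v v′ P P′ P∈ P′∈ (Q , refl) (Q′ , refl) same len =
  π≉π′ (Reconstruction.ranks-determined G π π′
         (Execution.queryPaths-sound G π v P∈) (Execution.queryPaths-sound G π′ v′ P′∈)
         (length-∷ʳ-cancel Q Q′ len) same)
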